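{- Let $P$ be a Laurent polynomial in $x_1,\ldots,x_r$ with integer coefficients and $p$ a prime, and suppose there exists $n\in\mathbb{N}$ with $\mathrm{ct}(P^n)\equiv0\pmod p$. Then for every Laurent polynomial $Q$ with integer coefficients, the set of indices $n\in\mathbb{N}$ with $\mathrm{ct}(P^nQ)\equiv 0\pmod p$ has density $1$ (i.e. the frequency of $0$ in $(\mathrm{ct}(P^nQ)\bmod p)_{n}$ is $1$). In particular, $(\mathrm{ct}(P^nQ)\bmod p)_n$ contains arbitrarily long runs of $0$s and is not uniformly recurrent.
   Context: $\mathrm{ct}(Q)$ denotes the constant term of a Laurent polynomial $Q$. A sequence $(s_n)$ is uniformly recurrent if for every finite word $w$ occurring in it there is $C_w$ such that every occurrence of $w$ is followed by another occurrence starting at distance at most $C_w$. Density of a set $S\subseteq\mathbb{N}$ means $\lim_{N\to\infty}|S\cap[0,N)|/N$. -}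

module Defs where

open import Data.Nat as ℕ using (ℕ; zero; suc; _≤_; _<_)
open import Data.Integer as ℤ using (ℤ; 0ℤ; 1ℤ)
open import Data.Integer.DivMod using (_%ℕ_)
open import Data.Nat.Primality using (Prime; prime⇒nonZero)
open import Data.Vec using (Vec; replicate; zipWith; lookup)
open import Data.Vec.Properties using (≡-dec)
open import Data.List using (List; []; _∷_; concatMap; map; filter; length; sum; upTo)
open import Data.Product using (_×_; _,_; proj₁; proj₂; ∃; ∃-syntax)
open import Data.Fin using (Fin; toℕ)
open import Relation.Nullary using (¬_; does)
open import Data.Bool using (true; false)
open import Relation.Binary.PropositionalEquality using (_≡_)

-- A Laurent polynomial in r variables x₁,…,x_r with integer coefficients,
-- represented as a finite formal sum of monomials  c · x^e  (e ∈ ℤ^r).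
-- (Repeated exponents are allowed; they simply add up.)
LaurentPoly : ℕ → Set
LaurentPoly r = List (Vec ℤ r × ℤ)

one : ∀ {r} → LaurentPoly r
one = (replicate _ 0ℤ , 1ℤ) ∷ []

_⊗_ : ∀ {r} → LaurentPoly r → LaurentPoly r → LaurentPoly r
P ⊗ Q = concatMap (λ m → map (λ m' → zipWith ℤ._+_ (proj₁ m) (proj₁ m') , proj₂ m ℤ.* proj₂ m') Q) P

_^^_ : ∀ {r} → LaurentPoly r → ℕ → LaurentPoly r
P ^^ zero  = one
P ^^ suc n = P ⊗ (P ^^ n)

ct : ∀ {r} → LaurentPoly r → ℤ
ct [] = 0ℤ
ct ((e , c) ∷ P) with does (≡-dec ℤ._≟_ e (replicate _ 0ℤ))
... | true  = c ℤ.+ ct P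
... | false = ct P

ctSeqMod : ∀ {r} (p : ℕ) → Prime p → LaurentPoly r → LaurentPoly r → ℕ → ℕ
ctSeqMod p pr P Q n = _%ℕ_ (ct ((P ^^ n) ⊗ Q)) p {{prime⇒nonZero pr}}

zeroCount : (ℕ → ℕ) → ℕ → ℕ
zeroCount s N = length (filter (λ n → s n ℕ.≟ 0) (upTo N))

-- the set {n | s n = 0} has density 1:
-- for every k, eventually k · #{n < N | s n ≠ 0} ≤ N,
-- i.e. #{n < N | s n ≠ 0}/N → 0, i.e. #{n < N | s n = 0}/N → 1.
ZeroDensityOne : (ℕ → ℕ) → Set
ZeroDensityOne s = ∀ (k : ℕ) → ∃[ N₀ ] ∀ (N : ℕ) → N₀ ≤ N → k ℕ.* (N ℕ.∸ zeroCount s N) ≤ N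

ArbLongZeroRuns : (ℕ → ℕ) → Set
ArbLongZeroRuns s = ∀ (L : ℕ) → ∃[ i ] ∀ (j : ℕ) → j < L → s (i ℕ.+ j) ≡ 0

OccursAt : {A : Set} → (ℕ → A) → ∀ {m} → Vec A m → ℕ → Set
OccursAt s {m} w i = ∀ (k : Fin m) → s (i ℕ.+ toℕ k) ≡ lookup w k

UniformlyRecurrent : {A : Set} → (ℕ → A) → Set
UniformlyRecurrent {A} s =
  ∀ (m : ℕ) (w : Vec A m) → ∃[ i ] OccursAt s w i →
  ∃[ C ] ∀ (i : ℕ) → OccursAt s w i →
    ∃[ j ] (i < j × j ≤ i ℕ.+ C × OccursAt s w j)

module Submission where

-- Modulo p, Frobenius and Fermat's little theorem give P^(p^i) ≡ P(x₁^(p^i),…,x_r^(p^i)), and if the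
-- exponents of A are smaller than p^i in absolute value then ct(A·P(x^(p^i))) = ct(A)·ct(P). So writing
-- n = a + p^(k+j)·(N₀ + p^t·m) in base p with a < p^k, where ct(P^N₀) ≡ 0 and j, t are large enough,
-- ct(P^n·Q) ≡ ct(P^a·Q)·ct(P^N₀)·ct(P^m) ≡ 0. Thus ct(P^n·Q) ≡ 0 whenever ⌊n/p^k⌋ ≡ w (mod q) for some
-- large k, with q = p^(j+t) and w = p^j·N₀, i.e. whenever a base-q digit of ⌊n/p^D⌋ equals w. Among q^M
-- consecutive integers only (q-1)^M avoid the digit w in their lowest M places, which gives density one;
-- the n with ⌊n/p^k⌋ = w form a run of p^k zeros, and arbitrarily long runs of zeros are incompatible
-- with uniform recurrence unless the sequence vanishes.

open import Defs
open import Level using (0ℓ)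
open import Function using (_∘_; it)
open import Algebra.Bundles using (CommutativeSemiring)
open import Algebra.Structures.Biased using (isCommutativeSemiringˡ; isCommutativeMonoidˡ)
open import Relation.Binary.Structures using (IsEquivalence)
open import Data.Bool using (if_then_else_)
open import Data.Empty using (⊥-elim)
open import Data.Product using (_×_; _,_; proj₁; proj₂; ∃-syntax; map₂)
open import Data.Fin as F using ()
open import Data.Sum using (inj₁; inj₂)
open import Data.Nat.Primality using (Prime; prime⇒nonZero; prime⇒nonTrivial)
open import Data.Integer.Divisibility.Signed using (∣ᵤ⇒∣) renaming (_∣_ to _∣ℤ_)
open import Data.Nat as ℕ using (ℕ; zero; suc; _≤_; _<_; _∸_; z≤n; s≤s; z<s; s<s; NonZero)
import Data.Nat.Properties as ℕP
open import Data.Integer as ℤ using (ℤ; 0ℤ; 1ℤ; -[1+_])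
import Data.Integer.Properties as ℤP
open import Data.Vec as V using (Vec; []; _∷_; replicate; zipWith)
open import Data.Vec.Properties using (≡-dec; ∷-injective)
open import Data.List using (List; []; _∷_; _++_; concatMap; map)
open import Relation.Nullary using (¬_; does; Dec; yes; no)
open import Relation.Nullary.Decidable using (dec-true; dec-false)
open import Relation.Binary.PropositionalEquality
  using (_≡_; _≢_; refl; sym; trans; cong; cong₂; subst; subst₂; module ≡-Reasoning)
open import Data.Bool using (true; false)

module LaurentArithmetic where

  open import Data.Integer using (_+_; _*_; _-_)
  open import Data.Integer.Solver using (module +-*-Solver)
  open +-*-Solver
  open import Data.Vec.Relation.Binary.Pointwise.Inductive
    using (Pointwise-≡⇒≡; zipWith-comm; zipWith-assoc; zipWith-identityˡ)
  open import Data.List.Relation.Unary.All using (All; []; _∷_)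

  private variable X Y : Set

  ∑ : List X → (X → ℤ) → ℤ
  ∑ []      f = 0ℤ
  ∑ (m ∷ A) f = f m + ∑ A f

  ∑-cong : ∀ (A : List X) {f g} → (∀ m → f m ≡ g m) → ∑ A f ≡ ∑ A g
  ∑-cong []      f≗g = refl
  ∑-cong (m ∷ A) f≗g = cong₂ _+_ (f≗g m) (∑-cong A f≗g)

  ∑-++ : ∀ (A B : List X) f → ∑ (A ++ B) f ≡ ∑ A f + ∑ B f
  ∑-++ []      B f = sym (ℤP.+-identityˡ _)
  ∑-++ (m ∷ A) B f = trans (cong (f m +_) (∑-++ A B f)) (sym (ℤP.+-assoc (f m) _ _))

  ∑-zero : ∀ (A : List X) → ∑ A (λ _ → 0ℤ) ≡ 0ℤ
  ∑-zero []      = refl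
  ∑-zero (m ∷ A) = trans (ℤP.+-identityˡ _) (∑-zero A)

  ∑-distrib-+ : ∀ (A : List X) f g → ∑ A (λ m → f m + g m) ≡ ∑ A f + ∑ A g
  ∑-distrib-+ []      f g = refl
  ∑-distrib-+ (m ∷ A) f g = trans (cong (f m + g m +_) (∑-distrib-+ A f g))
    (solve 4 (λ a b x y → (a :+ b) :+ (x :+ y) := (a :+ x) :+ (b :+ y)) refl (f m) (g m) (∑ A f) (∑ A g))

  ∑-distribˡ-* : ∀ (A : List X) c f → ∑ A (λ m → c * f m) ≡ c * ∑ A f
  ∑-distribˡ-* []      c f = sym (ℤP.*-zeroʳ c)
  ∑-distribˡ-* (m ∷ A) c f =
    trans (cong (c * f m +_) (∑-distribˡ-* A c f)) (sym (ℤP.*-distribˡ-+ c (f m) _))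

  ∑-comm : (A : List X) (B : List Y) (f : X → Y → ℤ) →
           ∑ A (λ m → ∑ B (f m)) ≡ ∑ B (λ m' → ∑ A (λ m → f m m'))
  ∑-comm []      B f = sym (∑-zero B)
  ∑-comm (m ∷ A) B f = trans (cong (∑ B (f m) +_) (∑-comm A B f))
                             (sym (∑-distrib-+ B (f m) (λ m' → ∑ A (λ m₀ → f m₀ m'))))

  ∑-map : ∀ (h : X → Y) (A : List X) f → ∑ (map h A) f ≡ ∑ A (f ∘ h)
  ∑-map h []      f = refl
  ∑-map h (m ∷ A) f = cong (f (h m) +_) (∑-map h A f)

  ∑-concatMap : ∀ (g : X → List Y) (A : List X) f →
                ∑ (concatMap g A) f ≡ ∑ A (λ m → ∑ (g m) f)
  ∑-concatMap g []      f = refl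
  ∑-concatMap g (m ∷ A) f =
    trans (∑-++ (g m) (concatMap g A) f) (cong (∑ (g m) f +_) (∑-concatMap g A f))

  ∑-cong-All : ∀ {P : X → Set} {A : List X} {f g} → All P A → (∀ {m} → P m → f m ≡ g m) → ∑ A f ≡ ∑ A g
  ∑-cong-All []         f≡g = refl
  ∑-cong-All (pm ∷ pA) f≡g = cong₂ _+_ (f≡g pm) (∑-cong-All pA f≡g)

  ∑-*-∑ : ∀ (A : List X) (B : List Y) f g → ∑ A f * ∑ B g ≡ ∑ A (λ m → ∑ B (λ m' → f m * g m'))
  ∑-*-∑ []      B f g = ℤP.*-zeroˡ (∑ B g)
  ∑-*-∑ (m ∷ A) B f g = begin
    (f m + ∑ A f) * ∑ B g                ≡⟨ ℤP.*-distribʳ-+ (∑ B g) (f m) (∑ A f) ⟩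
    f m * ∑ B g + ∑ A f * ∑ B g          ≡⟨ cong₂ _+_ (sym (∑-distribˡ-* B (f m) g)) (∑-*-∑ A B f g) ⟩
    ∑ B (λ m' → f m * g m') + ∑ A (λ m₀ → ∑ B (λ m' → f m₀ * g m')) ∎
    where open ≡-Reasoning

  infixl 6 _⊕_ _⊖_

  _⊕_ _⊖_ : ∀ {r} → Vec ℤ r → Vec ℤ r → Vec ℤ r
  _⊕_ = zipWith _+_
  _⊖_ = zipWith _-_

  0v : ∀ {r} → Vec ℤ r
  0v = replicate _ 0ℤ

  ⊕-comm : ∀ {r} (a b : Vec ℤ r) → a ⊕ b ≡ b ⊕ a
  ⊕-comm a b = Pointwise-≡⇒≡ (zipWith-comm ℤP.+-comm a b)

  ⊕-assoc : ∀ {r} (a b c : Vec ℤ r) → a ⊕ b ⊕ c ≡ a ⊕ (b ⊕ c)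
  ⊕-assoc a b c = Pointwise-≡⇒≡ (zipWith-assoc ℤP.+-assoc a b c)

  ⊕-identityˡ : ∀ {r} (a : Vec ℤ r) → 0v ⊕ a ≡ a
  ⊕-identityˡ a = Pointwise-≡⇒≡ (zipWith-identityˡ ℤP.+-identityˡ a)

  ⊕≡⇒≡⊖ : ∀ {r} (a b x : Vec ℤ r) → a ⊕ b ≡ x → b ≡ x ⊖ a
  ⊕≡⇒≡⊖ []      []      []      _  = refl
  ⊕≡⇒≡⊖ (u ∷ a) (v ∷ b) (w ∷ x) eq with refl , eqs ← ∷-injective eq =
    cong₂ _∷_ (solve 2 (λ u v → v := (u :+ v) :- u) refl u v) (⊕≡⇒≡⊖ a b x eqs)

  ≡⊖⇒⊕≡ : ∀ {r} (a b x : Vec ℤ r) → b ≡ x ⊖ a → a ⊕ b ≡ x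
  ≡⊖⇒⊕≡ []      []      []      _  = refl
  ≡⊖⇒⊕≡ (u ∷ a) (v ∷ b) (w ∷ x) eq with refl , eqs ← ∷-injective eq =
    cong₂ _∷_ (solve 2 (λ u w → u :+ (w :- u) := w) refl u w) (≡⊖⇒⊕≡ a b x eqs)

  Monomial : ℕ → Set
  Monomial r = Vec ℤ r × ℤ

  _⊙_ : ∀ {r} → Monomial r → Monomial r → Monomial r
  (a , c) ⊙ (b , d) = a ⊕ b , c * d

  ⊙-comm : ∀ {r} (m m' : Monomial r) → m ⊙ m' ≡ m' ⊙ m
  ⊙-comm (a , c) (b , d) = cong₂ _,_ (⊕-comm a b) (ℤP.*-comm c d)

  ⊙-assoc : ∀ {r} (m m' m'' : Monomial r) → (m ⊙ m') ⊙ m'' ≡ m ⊙ (m' ⊙ m'')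
  ⊙-assoc (a , c) (b , d) (e , f) = cong₂ _,_ (⊕-assoc a b e) (ℤP.*-assoc c d f)

  monomialCoeff : ∀ {r} → Monomial r → Vec ℤ r → ℤ
  monomialCoeff (e , c) x = if does (≡-dec ℤ._≟_ e x) then c else 0ℤ

  monomialCoeff-≡ : ∀ {r} {e x : Vec ℤ r} c → e ≡ x → monomialCoeff (e , c) x ≡ c
  monomialCoeff-≡ {e = e} {x} c eq rewrite dec-true (≡-dec ℤ._≟_ e x) eq = refl

  monomialCoeff-≢ : ∀ {r} {e x : Vec ℤ r} c → e ≢ x → monomialCoeff (e , c) x ≡ 0ℤ
  monomialCoeff-≢ {e = e} {x} c ne rewrite dec-false (≡-dec ℤ._≟_ e x) ne = refl

  monomialCoeff-⊙ : ∀ {r} (a : Vec ℤ r) c m x →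
                    monomialCoeff ((a , c) ⊙ m) x ≡ c * monomialCoeff m (x ⊖ a)
  monomialCoeff-⊙ a c (b , d) x = by-cases (≡-dec ℤ._≟_ (a ⊕ b) x)
    where
    by-cases : Dec (a ⊕ b ≡ x) → monomialCoeff (a ⊕ b , c * d) x ≡ c * monomialCoeff (b , d) (x ⊖ a)
    by-cases (yes eq) = trans (monomialCoeff-≡ (c * d) eq)
                              (cong (c *_) (sym (monomialCoeff-≡ d (⊕≡⇒≡⊖ a b x eq))))
    by-cases (no ne)  = trans (monomialCoeff-≢ (c * d) ne)
                              (trans (sym (ℤP.*-zeroʳ c))
                                     (cong (c *_) (sym (monomialCoeff-≢ d (ne ∘ ≡⊖⇒⊕≡ a b x)))))

  coeff : ∀ {r} → LaurentPoly r → Vec ℤ r → ℤ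
  coeff A x = ∑ A (λ m → monomialCoeff m x)

  ct≡coeff0 : ∀ {r} (A : LaurentPoly r) → ct A ≡ coeff A 0v
  ct≡coeff0 []            = refl
  ct≡coeff0 ((e , c) ∷ A) with does (≡-dec ℤ._≟_ e 0v)
  ... | true  = cong (c +_) (ct≡coeff0 A)
  ... | false = trans (ct≡coeff0 A) (sym (ℤP.+-identityˡ _))

  coeff-++ : ∀ {r} (A B : LaurentPoly r) x → coeff (A ++ B) x ≡ coeff A x + coeff B x
  coeff-++ A B x = ∑-++ A B _

  ∑-⊗ : ∀ {r} (A B : LaurentPoly r) f → ∑ (A ⊗ B) f ≡ ∑ A (λ m → ∑ B (λ m' → f (m ⊙ m')))
  ∑-⊗ A B f = trans (∑-concatMap _ A f) (∑-cong A (λ m → ∑-map _ B f))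

  coeff-⊗ : ∀ {r} (A B : LaurentPoly r) x →
            coeff (A ⊗ B) x ≡ ∑ A (λ (a , c) → c * coeff B (x ⊖ a))
  coeff-⊗ A B x = trans (∑-⊗ A B _) (∑-cong A λ (a , c) →
    trans (∑-cong B (λ m' → monomialCoeff-⊙ a c m' x)) (∑-distribˡ-* B c _))

  infix 4 _≐_
  _≐_ : ∀ {r} → LaurentPoly r → LaurentPoly r → Set
  A ≐ B = ∀ x → coeff A x ≡ coeff B x

  ⊗-comm : ∀ {r} (A B : LaurentPoly r) → A ⊗ B ≐ B ⊗ A
  ⊗-comm A B x = begin
    coeff (A ⊗ B) x                                       ≡⟨ ∑-⊗ A B _ ⟩
    ∑ A (λ m → ∑ B (λ m' → monomialCoeff (m ⊙ m') x))     ≡⟨ ∑-comm A B _ ⟩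
    ∑ B (λ m' → ∑ A (λ m → monomialCoeff (m ⊙ m') x))     ≡⟨ ∑-cong B (λ m' → ∑-cong A λ m →
                                                              cong (λ m₀ → monomialCoeff m₀ x) (⊙-comm m m')) ⟩
    ∑ B (λ m' → ∑ A (λ m → monomialCoeff (m' ⊙ m) x))     ≡⟨ ∑-⊗ B A _ ⟨
    coeff (B ⊗ A) x                                       ∎
    where open ≡-Reasoning

  ⊗-assoc : ∀ {r} (A B C : LaurentPoly r) → (A ⊗ B) ⊗ C ≐ A ⊗ (B ⊗ C)
  ⊗-assoc A B C x = begin
    coeff ((A ⊗ B) ⊗ C) x
      ≡⟨ ∑-⊗ (A ⊗ B) C _ ⟩
    ∑ (A ⊗ B) (λ m → ∑ C (λ m'' → monomialCoeff (m ⊙ m'') x))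
      ≡⟨ ∑-⊗ A B _ ⟩
    ∑ A (λ m → ∑ B (λ m' → ∑ C (λ m'' → monomialCoeff ((m ⊙ m') ⊙ m'') x)))
      ≡⟨ ∑-cong A (λ m → ∑-cong B λ m' →
        ∑-cong C λ m'' → cong (λ m₀ → monomialCoeff m₀ x) (⊙-assoc m m' m'')) ⟩
    ∑ A (λ m → ∑ B (λ m' → ∑ C (λ m'' → monomialCoeff (m ⊙ (m' ⊙ m'')) x)))
      ≡⟨ ∑-cong A (λ m → ∑-⊗ B C _) ⟨
    ∑ A (λ m → ∑ (B ⊗ C) (λ m' → monomialCoeff (m ⊙ m') x))
      ≡⟨ ∑-⊗ A (B ⊗ C) _ ⟨
    coeff (A ⊗ (B ⊗ C)) x ∎
    where open ≡-Reasoning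

  ⊗-identityˡ : ∀ {r} (A : LaurentPoly r) → one ⊗ A ≐ A
  ⊗-identityˡ A x = trans (∑-⊗ one A _) (trans (ℤP.+-identityʳ _) (∑-cong A λ (b , d) →
    cong (λ m → monomialCoeff m x) (cong₂ _,_ (⊕-identityˡ b) (ℤP.*-identityˡ d))))

  ⊗-distribʳ-++ : ∀ {r} (A B C : LaurentPoly r) → (A ++ B) ⊗ C ≐ (A ⊗ C) ++ (B ⊗ C)
  ⊗-distribʳ-++ A B C x = begin
    coeff ((A ++ B) ⊗ C) x                           ≡⟨ ∑-⊗ (A ++ B) C _ ⟩
    ∑ (A ++ B) _                                     ≡⟨ ∑-++ A B _ ⟩
    ∑ A _ + ∑ B _                                    ≡⟨ cong₂ _+_ (∑-⊗ A C _) (∑-⊗ B C _) ⟨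
    coeff (A ⊗ C) x + coeff (B ⊗ C) x                ≡⟨ coeff-++ (A ⊗ C) (B ⊗ C) x ⟨
    coeff ((A ⊗ C) ++ (B ⊗ C)) x                     ∎
    where open ≡-Reasoning

module Dilation where

  open LaurentArithmetic
  open import Data.Integer using (_+_; _*_; -_; +_; ∣_∣)
  open import Algebra.Properties.AbelianGroup ℤP.+-0-abelianGroup using (inverseˡ-unique)
  open import Data.List.Relation.Unary.All as All using (All; []; _∷_)
  import Data.List.Relation.Unary.All.Properties as All
  import Data.List.Properties as List
  import Data.Vec.Relation.Unary.All as VAll

  infixr 8 _·_
  _·_ : ∀ {r} → ℕ → Vec ℤ r → Vec ℤ r
  s · e = V.map ((+ s) *_) e

  dilate : ∀ {r} → ℕ → LaurentPoly r → LaurentPoly r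
  dilate s = map (λ (e , c) → s · e , c)

  ·-distrib-⊕ : ∀ {r} s (a b : Vec ℤ r) → s · (a ⊕ b) ≡ s · a ⊕ s · b
  ·-distrib-⊕ s []      []      = refl
  ·-distrib-⊕ s (y ∷ a) (z ∷ b) = cong₂ _∷_ (ℤP.*-distribˡ-+ (+ s) y z) (·-distrib-⊕ s a b)

  ·-assoc : ∀ {r} s t (e : Vec ℤ r) → s · t · e ≡ (s ℕ.* t) · e
  ·-assoc s t []      = refl
  ·-assoc s t (z ∷ e) =
    cong₂ _∷_ (trans (sym (ℤP.*-assoc (+ s) (+ t) z)) (cong (_* z) (sym (ℤP.pos-* s t)))) (·-assoc s t e)

  ·-identityˡ : ∀ {r} (e : Vec ℤ r) → 1 · e ≡ e
  ·-identityˡ []      = refl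
  ·-identityˡ (z ∷ e) = cong₂ _∷_ (ℤP.*-identityˡ z) (·-identityˡ e)

  ·-zeroˡ : ∀ {r} (e : Vec ℤ r) → 0 · e ≡ 0v
  ·-zeroˡ []      = refl
  ·-zeroˡ (z ∷ e) = cong (0ℤ ∷_) (·-zeroˡ e)

  ·-zeroʳ : ∀ {r} s → s · 0v {r} ≡ 0v
  ·-zeroʳ {zero}  s = refl
  ·-zeroʳ {suc r} s = cong₂ _∷_ (ℤP.*-zeroʳ (+ s)) (·-zeroʳ s)

  ·-suc : ∀ {r} n (e : Vec ℤ r) → e ⊕ n · e ≡ suc n · e
  ·-suc n []      = refl
  ·-suc n (z ∷ e) = cong₂ _∷_ (sym (ℤP.suc-* (+ n) z)) (·-suc n e)

  dilate-dilate : ∀ {r} s t (P : LaurentPoly r) → dilate s (dilate t P) ≡ dilate (s ℕ.* t) P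
  dilate-dilate s t P = trans (sym (List.map-∘ P)) (List.map-cong (λ (e , c) → cong (_, c) (·-assoc s t e)) P)

  dilate-identity : ∀ {r} (P : LaurentPoly r) → dilate 1 P ≡ P
  dilate-identity P = trans (List.map-cong (λ (e , c) → cong (_, c) (·-identityˡ e)) P) (List.map-id P)

  dilate-⊗ : ∀ {r} s (A B : LaurentPoly r) → dilate s (A ⊗ B) ≡ dilate s A ⊗ dilate s B
  dilate-⊗ s A B = begin
    map D (concatMap (λ m → map (m ⊙_) B) A)        ≡⟨ List.map-concatMap D _ A ⟩
    concatMap (λ m → map D (map (m ⊙_) B)) A        ≡⟨ List.concatMap-cong D-⊙ A ⟩
    concatMap (λ m → map (D m ⊙_) (map D B)) A      ≡⟨ List.concatMap-map _ D A ⟨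
    concatMap (λ m → map (m ⊙_) (map D B)) (map D A) ∎
    where
    open ≡-Reasoning
    D = λ ((e , c) : Monomial _) → s · e , c
    D-⊙ : ∀ m → map D (map (m ⊙_) B) ≡ map (D m ⊙_) (map D B)
    D-⊙ (a , c) = trans (sym (List.map-∘ B)) (trans
      (List.map-cong (λ (b , d) → cong (_, c * d) (·-distrib-⊕ s a b)) B) (List.map-∘ B))

  dilate-^^ : ∀ {r} s (P : LaurentPoly r) n → dilate s (P ^^ n) ≡ dilate s P ^^ n
  dilate-^^ s P zero    = cong (λ e → (e , 1ℤ) ∷ []) (·-zeroʳ s)
  dilate-^^ s P (suc n) = trans (dilate-⊗ s P (P ^^ n)) (cong (dilate s P ⊗_) (dilate-^^ s P n))

  Within : ∀ {r} → ℕ → Vec ℤ r → Set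
  Within B = VAll.All (λ z → ∣ z ∣ ≤ B)

  ExponentsWithin : ∀ {r} → ℕ → LaurentPoly r → Set
  ExponentsWithin B = All (Within B ∘ proj₁)

  within-mono : ∀ {r B B'} → B ≤ B' → {e : Vec ℤ r} → Within B e → Within B' e
  within-mono B≤B' = VAll.map (λ ∣z∣≤B → ℕP.≤-trans ∣z∣≤B B≤B')

  exponentsWithin-mono : ∀ {r B B'} → B ≤ B' → {A : LaurentPoly r} → ExponentsWithin B A → ExponentsWithin B' A
  exponentsWithin-mono B≤B' = All.map (within-mono B≤B')

  within-0v : ∀ {r} → Within 0 (0v {r})
  within-0v {zero}  = VAll.[]
  within-0v {suc r} = z≤n VAll.∷ within-0v

  within-⊕ : ∀ {r B B'} {a b : Vec ℤ r} → Within B a → Within B' b → Within (B ℕ.+ B') (a ⊕ b)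
  within-⊕ VAll.[]         VAll.[]         = VAll.[]
  within-⊕ {a = y ∷ _} {z ∷ _} (ha VAll.∷ has) (hb VAll.∷ hbs) =
    ℕP.≤-trans (ℤP.∣i+j∣≤∣i∣+∣j∣ y z) (ℕP.+-mono-≤ ha hb) VAll.∷ within-⊕ has hbs

  exponentsWithin-⊗ : ∀ {r B B'} {A C : LaurentPoly r} →
                      ExponentsWithin B A → ExponentsWithin B' C → ExponentsWithin (B ℕ.+ B') (A ⊗ C)
  exponentsWithin-⊗ []         hC = []
  exponentsWithin-⊗ (ha ∷ hAs) hC = All.++⁺ (All.map⁺ (All.map (within-⊕ ha) hC)) (exponentsWithin-⊗ hAs hC)

  exponentsWithin-^^ : ∀ {r d} {P : LaurentPoly r} n → ExponentsWithin d P → ExponentsWithin (n ℕ.* d) (P ^^ n)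
  exponentsWithin-^^ zero    hP = within-0v ∷ []
  exponentsWithin-^^ (suc n) hP = exponentsWithin-⊗ hP (exponentsWithin-^^ n hP)

  within-exists : ∀ {r} (e : Vec ℤ r) → ∃[ B ] Within B e
  within-exists []      = 0 , VAll.[]
  within-exists (z ∷ e) with B , he ← within-exists e =
    ∣ z ∣ ℕ.+ B , ℕP.m≤m+n _ _ VAll.∷ within-mono (ℕP.m≤n+m B _) he

  exponentsWithin-exists : ∀ {r} (A : LaurentPoly r) → ∃[ B ] ExponentsWithin B A
  exponentsWithin-exists []            = 0 , []
  exponentsWithin-exists ((e , _) ∷ A) with B , he ← within-exists e | B' , hA ← exponentsWithin-exists A =
    B ℕ.+ B' , within-mono (ℕP.m≤m+n B B') he ∷ exponentsWithin-mono (ℕP.m≤n+m B' B) hA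

  separate : ∀ {S a b} → ∣ a ∣ < S → a + + S * b ≡ 0ℤ → a ≡ 0ℤ × b ≡ 0ℤ
  separate {S} {a} {b} ∣a∣<S a+Sb≡0 with b ℤ.≟ 0ℤ
  ... | yes b≡0 = trans a≡-Sb (cong -_ (trans (cong (+ S *_) b≡0) (ℤP.*-zeroʳ (+ S)))) , b≡0
    where a≡-Sb = inverseˡ-unique a (+ S * b) a+Sb≡0
  ... | no b≢0 = ⊥-elim (ℕP.<⇒≱ ∣a∣<S (begin
      S                     ≤⟨ ℕP.m≤m*n S ∣ b ∣ ⟩
      S ℕ.* ∣ b ∣           ≡⟨ ℤP.abs-* (+ S) b ⟨
      ∣ + S * b ∣           ≡⟨ ℤP.∣-i∣≡∣i∣ (+ S * b) ⟨
      ∣ - (+ S * b) ∣       ≡⟨ cong ∣_∣ (inverseˡ-unique a (+ S * b) a+Sb≡0) ⟨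
      ∣ a ∣                 ∎))
    where
    open ℕP.≤-Reasoning
    instance _ = ℕ.≢-nonZero (b≢0 ∘ ℤP.∣i∣≡0⇒i≡0)

  within-separate : ∀ {r B S} {a b : Vec ℤ r} → Within B a → B < S → a ⊕ S · b ≡ 0v → a ≡ 0v × b ≡ 0v
  within-separate {a = []}    {[]}    VAll.[]         _   _  = refl , refl
  within-separate {a = y ∷ a} {z ∷ b} (hy VAll.∷ ha) B<S eq
    with eqy , eqs ← ∷-injective eq
    with y≡0 , z≡0 ← separate (ℕP.≤-<-trans hy B<S) eqy | a≡0 , b≡0 ← within-separate ha B<S eqs
    = cong₂ _∷_ y≡0 a≡0 , cong₂ _∷_ z≡0 b≡0

  monomialCoeff₀-⊙-dilate : ∀ {r B S} {a : Vec ℤ r} → Within B a → B < S → ∀ c b d →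
    monomialCoeff ((a , c) ⊙ (S · b , d)) 0v ≡ monomialCoeff (a , c) 0v * monomialCoeff (b , d) 0v
  monomialCoeff₀-⊙-dilate {S = S} {a} ha B<S c b d = by-cases (≡-dec ℤ._≟_ (a ⊕ S · b) 0v)
    where
    rhs≡0 : a ⊕ S · b ≢ 0v → Dec (a ≡ 0v) → Dec (b ≡ 0v) →
            monomialCoeff (a , c) 0v * monomialCoeff (b , d) 0v ≡ 0ℤ
    rhs≡0 _  (no a≢0)   _          =
      trans (cong (_* monomialCoeff (b , d) 0v) (monomialCoeff-≢ c a≢0)) (ℤP.*-zeroˡ (monomialCoeff (b , d) 0v))
    rhs≡0 _  (yes _)    (no b≢0)   =
      trans (cong (monomialCoeff (a , c) 0v *_) (monomialCoeff-≢ d b≢0)) (ℤP.*-zeroʳ (monomialCoeff (a , c) 0v))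
    rhs≡0 ne (yes refl) (yes refl) = ⊥-elim (ne (trans (cong (0v ⊕_) (·-zeroʳ S)) (⊕-identityˡ 0v)))

    by-cases : Dec (a ⊕ S · b ≡ 0v) →
      monomialCoeff (a ⊕ S · b , c * d) 0v ≡ monomialCoeff (a , c) 0v * monomialCoeff (b , d) 0v
    by-cases (yes eq) with a≡0 , b≡0 ← within-separate ha B<S eq =
      trans (monomialCoeff-≡ (c * d) eq) (sym (cong₂ _*_ (monomialCoeff-≡ c a≡0) (monomialCoeff-≡ d b≡0)))
    by-cases (no ne) = trans (monomialCoeff-≢ (c * d) ne) (sym (rhs≡0 ne (≡-dec ℤ._≟_ a 0v) (≡-dec ℤ._≟_ b 0v)))

  -- The exponents of A are too small to cancel a nonzero exponent of the dilated factor.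
  ct-⊗-dilate : ∀ {r B S} {A : LaurentPoly r} → ExponentsWithin B A → B < S →
                ∀ C → ct (A ⊗ dilate S C) ≡ ct A * ct C
  ct-⊗-dilate {S = S} {A} hA B<S C = begin
    ct (A ⊗ dilate S C)
      ≡⟨ ct≡coeff0 (A ⊗ dilate S C) ⟩
    ∑ (A ⊗ dilate S C) (λ m → monomialCoeff m 0v)
      ≡⟨ ∑-⊗ A (dilate S C) _ ⟩
    ∑ A (λ m → ∑ (dilate S C) (λ m' → monomialCoeff (m ⊙ m') 0v))
      ≡⟨ ∑-cong A (λ m → ∑-map _ C (λ m' → monomialCoeff (m ⊙ m') 0v)) ⟩
    ∑ A (λ m → ∑ C (λ (b , d) → monomialCoeff (m ⊙ (S · b , d)) 0v))
      ≡⟨ ∑-cong-All hA (λ {(a , c)} ha →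
        ∑-cong C λ (b , d) → monomialCoeff₀-⊙-dilate ha B<S c b d) ⟩
    ∑ A (λ m → ∑ C (λ m' → monomialCoeff m 0v * monomialCoeff m' 0v))
      ≡⟨ ∑-*-∑ A C _ _ ⟨
    coeff A 0v * coeff C 0v
      ≡⟨ cong₂ _*_ (ct≡coeff0 A) (ct≡coeff0 C) ⟨
    ct A * ct C ∎
    where open ≡-Reasoning

module Frobenius where

  open import Data.Nat using (_*_; _!)
  open import Data.Nat.Properties using (_!*_!≢0)
  open import Data.Nat.Divisibility using (_∣_; _∤_; ∣1⇒≡1; ∣⇒≤; m∣m*n)
  open import Data.Nat.DivMod using (m/n*n≡m)
  open import Data.Nat.Combinatorics using (_C_; nCk≡n!/k![n-k]!; k![n∸k]!∣n!; nCn≡1)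
  open import Data.Nat.Primality using (euclidsLemma; ¬prime[0]; ¬prime[1])
  open import Data.Fin as F using (Fin; toℕ; fromℕ)
  open import Data.Fin.Properties using (toℕ-fromℕ)

  prime∤m! : ∀ {p} → Prime p → ∀ m → m < p → p ∤ m !
  prime∤m! pr zero    _   p∣1 with refl ← ∣1⇒≡1 p∣1 = ¬prime[1] pr
  prime∤m! pr (suc m) m<p p∣m! with euclidsLemma (suc m) (m !) pr p∣m!
  ... | inj₁ p∣m = ℕP.<⇒≱ m<p (∣⇒≤ p∣m)
  ... | inj₂ p∣m! = prime∤m! pr m (ℕP.<-trans (ℕP.n<1+n m) m<p) p∣m!

  -- p! = pCk · k! (p-k)! and p divides neither factorial on the right.
  prime∣pCk : ∀ {p} → Prime p → ∀ k → 0 < k → k < p → p ∣ p C k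
  prime∣pCk {suc p-1} pr k 0<k k<p
    with euclidsLemma (p C k) (k ! * (p ∸ k) !) pr p∣pCk*k![p-k]!
    where
    p = suc p-1
    instance _ = k !* (p ∸ k) !≢0
    p∣pCk*k![p-k]! : p ∣ (p C k) * (k ! * (p ∸ k) !)
    p∣pCk*k![p-k]! = subst (p ∣_) (sym (trans
      (cong (_* (k ! * (p ∸ k) !)) (nCk≡n!/k![n-k]! (ℕP.<⇒≤ k<p)))
      (m/n*n≡m (k![n∸k]!∣n! (ℕP.<⇒≤ k<p))))) (m∣m*n (p-1 !))
  ... | inj₁ p∣pCk = p∣pCk
  ... | inj₂ p∣k![p-k]! with euclidsLemma (k !) ((suc p-1 ∸ k) !) pr p∣k![p-k]!
  ... | inj₁ p∣k! = ⊥-elim (prime∤m! pr k k<p p∣k!)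
  ... | inj₂ p∣[p-k]! = ⊥-elim (prime∤m! pr (suc p-1 ∸ k) (ℕP.∸-monoʳ-< 0<k (ℕP.<⇒≤ k<p)) p∣[p-k]!)

  module _ {a ℓ} (R : CommutativeSemiring a ℓ) where

    open CommutativeSemiring R hiding (refl; sym) renaming (trans to ≈-trans)
    open import Algebra.Properties.CommutativeSemiring.Binomial R using (theorem; binomialTerm)
    open import Algebra.Properties.Semiring.Exp semiring using (_^_)
    open import Algebra.Definitions.RawMonoid +-rawMonoid using (sum) renaming (_×_ to _·_)
    open import Relation.Binary.Reasoning.Setoid setoid

    sum≈last : ∀ m (g : Fin (suc m) → Carrier) → (∀ i → toℕ i < m → g i ≈ 0#) → sum g ≈ g (fromℕ m)
    sum≈last zero    g _     = +-identityʳ (g F.zero)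
    sum≈last (suc m) g g≈0 = ≈-trans
      (+-cong (g≈0 F.zero z<s) (sum≈last m (g ∘ F.suc) (λ i i<m → g≈0 (F.suc i) (s≤s i<m))))
      (+-identityˡ _)

    prime-^-distrib-+ : ∀ {p} → Prime p → (∀ n x → p ∣ n → n · x ≈ 0#) →
                        ∀ x y → (x + y) ^ p ≈ x ^ p + y ^ p
    prime-^-distrib-+ {zero}    pr _ = ⊥-elim (¬prime[0] pr)
    prime-^-distrib-+ {suc p-1} pr p×≈0 x y = begin
      (x + y) ^ p                                                    ≈⟨ theorem p x y ⟩
      binomialTerm x y p F.zero + sum (binomialTerm x y p ∘ F.suc)   ≈⟨ +-cong first (sum≈last p-1 _ middle) ⟩
      y ^ p + binomialTerm x y p (F.suc (fromℕ p-1))                 ≈⟨ +-congˡ last ⟩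
      y ^ p + x ^ p                                                  ≈⟨ +-comm _ _ ⟩
      x ^ p + y ^ p                                                  ∎
      where
      p = suc p-1
      first : binomialTerm x y p F.zero ≈ y ^ p
      first = ≈-trans (+-identityʳ _) (*-identityˡ _)
      middle : ∀ i → toℕ i < p-1 → binomialTerm x y p (F.suc i) ≈ 0#
      middle i i<p-1 = p×≈0 _ _ (prime∣pCk pr (suc (toℕ i)) z<s (s≤s i<p-1))
      last : binomialTerm x y p (F.suc (fromℕ p-1)) ≈ x ^ p
      last rewrite toℕ-fromℕ p-1 | nCn≡1 p | ℕP.n∸n≡0 p-1 = ≈-trans (+-identityʳ _) (*-identityʳ _)

module Congruence (p : ℕ) where

  open import Data.Integer using (_+_; _*_; _-_; -_; +_)
  open import Data.Integer.Divisibility.Signed as Div using (_∣_; divides)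
  open import Data.Nat.Divisibility using () renaming (divides to dividesℕ)
  import Data.Nat.DivMod as ℕDM
  open import Data.Integer.Solver using (module +-*-Solver)
  open +-*-Solver
  open LaurentArithmetic using (∑)

  infix 4 _≡ₚ_
  -- A record rather than a synonym, so that x and y can be inferred from x ≡ₚ y.
  record _≡ₚ_ (x y : ℤ) : Set where
    constructor mkₚ
    field divides-difference : + p ∣ x - y
  open _≡ₚ_ public

  ≡⇒≡ₚ : ∀ {x y} → x ≡ y → x ≡ₚ y
  ≡⇒≡ₚ {x} refl = mkₚ (divides 0ℤ (trans (ℤP.+-inverseʳ x) (sym (ℤP.*-zeroˡ (+ p)))))

  ≡ₚ-refl : ∀ {x} → x ≡ₚ x
  ≡ₚ-refl = ≡⇒≡ₚ refl

  ≡ₚ-sym : ∀ {x y} → x ≡ₚ y → y ≡ₚ x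
  ≡ₚ-sym {x} {y} (mkₚ x≡y) = mkₚ (subst (+ p ∣_) (solve 2 (λ x y → :- (x :- y) := y :- x) refl x y) (Div.∣m⇒∣-m x≡y))

  ≡ₚ-trans : ∀ {x y z} → x ≡ₚ y → y ≡ₚ z → x ≡ₚ z
  ≡ₚ-trans {x} {y} {z} (mkₚ x≡y) (mkₚ y≡z) = mkₚ (subst (+ p ∣_) (ℤP.+-minus-telescope x y z) (Div.∣m∣n⇒∣m+n x≡y y≡z))

  +-congₚ : ∀ {x y x' y'} → x ≡ₚ y → x' ≡ₚ y' → x + x' ≡ₚ y + y'
  +-congₚ {x} {y} {x'} {y'} (mkₚ x≡y) (mkₚ x'≡y') = mkₚ (
    subst (+ p ∣_) (solve 4 (λ x y x' y' → (x :- y) :+ (x' :- y') := (x :+ x') :- (y :+ y')) refl x y x' y')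
          (Div.∣m∣n⇒∣m+n x≡y x'≡y'))

  *-congˡₚ : ∀ c {x y} → x ≡ₚ y → c * x ≡ₚ c * y
  *-congˡₚ c {x} {y} (mkₚ x≡y) =
    mkₚ (subst (+ p ∣_) (solve 3 (λ c x y → c :* (x :- y) := c :* x :- c :* y) refl c x y) (Div.∣n⇒∣m*n c x≡y))

  *-congₚ : ∀ {x y x' y'} → x ≡ₚ y → x' ≡ₚ y' → x * x' ≡ₚ y * y'
  *-congₚ {x} {y} {x'} {y'} x≡y x'≡y' = ≡ₚ-trans
    (subst₂ _≡ₚ_ (ℤP.*-comm x' x) (ℤP.*-comm x' y) (*-congˡₚ x' x≡y))
    (*-congˡₚ y x'≡y')

  ∣⇒≡ₚ0 : ∀ {x} → + p ∣ x → x ≡ₚ 0ℤ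
  ∣⇒≡ₚ0 {x} p∣x = mkₚ (subst (+ p ∣_) (sym (ℤP.+-identityʳ x)) p∣x)

  ≡ₚ-∣ : ∀ {x y} → x ≡ₚ y → + p ∣ y → + p ∣ x
  ≡ₚ-∣ {x} {y} (mkₚ x≡y) p∣y = subst (+ p ∣_) (solve 2 (λ x y → (x :- y) :+ y := x) refl x y) (Div.∣m∣n⇒∣m+n x≡y p∣y)

  -‿congₚ : ∀ {x y} → x ≡ₚ y → - x ≡ₚ - y
  -‿congₚ {x} {y} (mkₚ x≡y) =
    mkₚ (subst (+ p ∣_) (solve 2 (λ x y → :- (x :- y) := (:- x) :- (:- y)) refl x y) (Div.∣m⇒∣-m x≡y))

  x+y≡ₚ0⇒y≡ₚ-x : ∀ {x y} → x + y ≡ₚ 0ℤ → y ≡ₚ - x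
  x+y≡ₚ0⇒y≡ₚ-x {x} {y} (mkₚ x+y≡0) =
    mkₚ (subst (+ p ∣_) (solve 2 (λ x y → (x :+ y) :- con 0ℤ := y :- (:- x)) refl x y) x+y≡0)

  ∣⇒%ℕ≡0 : ∀ {z} .{{_ : NonZero p}} → + p ∣ z → z ℤ.%ℕ p ≡ 0
  ∣⇒%ℕ≡0 {+ n}      p∣z with dividesℕ q eq ← Div.∣⇒∣ᵤ p∣z = trans (cong (ℕ._% p) eq) (ℕDM.m*n%n≡0 q p)
  ∣⇒%ℕ≡0 { -[1+ n ]} p∣z with dividesℕ q eq ← Div.∣⇒∣ᵤ p∣z rewrite trans (cong (ℕ._% p) eq) (ℕDM.m*n%n≡0 q p) = refl

  ∑-congₚ : ∀ {X : Set} (A : List X) {f g} → (∀ m → f m ≡ₚ g m) → ∑ A f ≡ₚ ∑ A g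
  ∑-congₚ []      _   = ≡ₚ-refl
  ∑-congₚ (m ∷ A) f≡g = +-congₚ (f≡g m) (∑-congₚ A f≡g)

  ≡ₚ-isEquivalence : IsEquivalence _≡ₚ_
  ≡ₚ-isEquivalence = record { refl = ≡ₚ-refl ; sym = ≡ₚ-sym ; trans = ≡ₚ-trans }

  ℤ/p : CommutativeSemiring 0ℓ 0ℓ
  ℤ/p = record
    { _≈_ = _≡ₚ_ ; _+_ = _+_ ; _*_ = _*_ ; 0# = 0ℤ ; 1# = 1ℤ
    ; isCommutativeSemiring = isCommutativeSemiringˡ record
      { +-isCommutativeMonoid = isCommutativeMonoidˡ record
        { isSemigroup = record
          { isMagma = record { isEquivalence = ≡ₚ-isEquivalence ; ∙-cong = +-congₚ }
          ; assoc = λ x y z → ≡⇒≡ₚ (ℤP.+-assoc x y z) }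
        ; identityˡ = ≡⇒≡ₚ ∘ ℤP.+-identityˡ
        ; comm = λ x y → ≡⇒≡ₚ (ℤP.+-comm x y) }
      ; *-isCommutativeMonoid = isCommutativeMonoidˡ record
        { isSemigroup = record
          { isMagma = record { isEquivalence = ≡ₚ-isEquivalence ; ∙-cong = *-congₚ }
          ; assoc = λ x y z → ≡⇒≡ₚ (ℤP.*-assoc x y z) }
        ; identityˡ = ≡⇒≡ₚ ∘ ℤP.*-identityˡ
        ; comm = λ x y → ≡⇒≡ₚ (ℤP.*-comm x y) }
      ; distribʳ = λ x y z → ≡⇒≡ₚ (ℤP.*-distribʳ-+ x y z)
      ; zeroˡ = ≡⇒≡ₚ ∘ ℤP.*-zeroˡ } }

module Fermat {p : ℕ} (pr : Prime p) where

  open Congruence p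
  open import Data.Integer using (_+_; _*_; -_; +_; _^_)
  import Data.Integer.Divisibility.Signed as Div
  open import Data.Nat.Divisibility using () renaming (_∣_ to _∣ℕ_)
  open import Algebra.Properties.Semiring.Exp (CommutativeSemiring.semiring ℤ/p) using ()
    renaming (_^_ to _^ₚ_)
  open import Algebra.Definitions.RawMonoid (CommutativeSemiring.+-rawMonoid ℤ/p) using ()
    renaming (_×_ to _·_)
  open Frobenius using (prime-^-distrib-+)

  ·≡* : ∀ n x → n · x ≡ + n * x
  ·≡* zero    x = sym (ℤP.*-zeroˡ x)
  ·≡* (suc n) x = trans (cong (λ y → x + y) (·≡* n x)) (sym (ℤP.suc-* (+ n) x))

  ^ₚ≡^ : ∀ x n → x ^ₚ n ≡ x ^ n
  ^ₚ≡^ x zero    = refl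
  ^ₚ≡^ x (suc n) = cong (x *_) (^ₚ≡^ x n)

  ^p-distrib-+ : ∀ x y → (x + y) ^ p ≡ₚ x ^ p + y ^ p
  ^p-distrib-+ x y = subst₂ _≡ₚ_ (^ₚ≡^ (x + y) p) (cong₂ _+_ (^ₚ≡^ x p) (^ₚ≡^ y p))
    (prime-^-distrib-+ ℤ/p pr p∣n⇒n·x≡0 x y)
    where
    p∣n⇒n·x≡0 : ∀ n x → p ∣ℕ n → n · x ≡ₚ 0ℤ
    p∣n⇒n·x≡0 n x p∣n rewrite ·≡* n x = ∣⇒≡ₚ0 (Div.∣m⇒∣m*n {m = + n} x (Div.∣ᵤ⇒∣ p∣n))

  fermat-ℕ : ∀ n → (+ n) ^ p ≡ₚ + n
  fermat-ℕ zero    = ≡⇒≡ₚ (0^n≡0 p {{prime⇒nonZero pr}})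
    where
    0^n≡0 : ∀ n → .{{NonZero n}} → 0ℤ ^ n ≡ 0ℤ
    0^n≡0 (suc n) = refl
  fermat-ℕ (suc n) = ≡ₚ-trans (^p-distrib-+ 1ℤ (+ n)) (+-congₚ (≡⇒≡ₚ (ℤP.^-zeroˡ p)) (fermat-ℕ n))

  -‿^p : ∀ x → (- x) ^ p ≡ₚ - (x ^ p)
  -‿^p x = x+y≡ₚ0⇒y≡ₚ-x (≡ₚ-trans (≡ₚ-sym (^p-distrib-+ x (- x)))
                                 (subst (λ z → z ^ p ≡ₚ 0ℤ) (sym (ℤP.+-inverseʳ x)) (fermat-ℕ 0)))

  fermat : ∀ c → c ^ p ≡ₚ c
  fermat (+ n)    = fermat-ℕ n
  fermat -[1+ n ] = ≡ₚ-trans (-‿^p (+ suc n)) (-‿congₚ (fermat-ℕ (suc n)))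

module LaurentModP {p : ℕ} (pr : Prime p) (r : ℕ) where

  open LaurentArithmetic
  open Dilation
  open Congruence p
  open import Data.Integer using (_+_; _*_; +_; _^_)
  import Data.Integer.Divisibility.Signed as Div
  open import Data.Nat.Divisibility using () renaming (_∣_ to _∣ℕ_)
  import Data.List.Properties as List

  infix 4 _≈_
  record _≈_ (A B : LaurentPoly r) : Set where
    constructor mk≈
    field coeff-≡ₚ : ∀ x → coeff A x ≡ₚ coeff B x
  open _≈_

  ≐⇒≈ : ∀ {A B} → A ≐ B → A ≈ B
  ≐⇒≈ A≐B = mk≈ (≡⇒≡ₚ ∘ A≐B)

  ≡⇒≈ : ∀ {A B} → A ≡ B → A ≈ B
  ≡⇒≈ refl = mk≈ λ _ → ≡ₚ-refl

  ≈-isEquivalence : IsEquivalence _≈_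
  ≈-isEquivalence = record
    { refl  = mk≈ λ _ → ≡ₚ-refl
    ; sym   = λ A≈B → mk≈ λ x → ≡ₚ-sym (coeff-≡ₚ A≈B x)
    ; trans = λ A≈B B≈C → mk≈ λ x → ≡ₚ-trans (coeff-≡ₚ A≈B x) (coeff-≡ₚ B≈C x)
    }

  open IsEquivalence ≈-isEquivalence public using () renaming (refl to ≈-refl; sym to ≈-sym; trans to ≈-trans)

  ++-cong : ∀ {A A' B B'} → A ≈ A' → B ≈ B' → A ++ B ≈ A' ++ B'
  ++-cong {A} {A'} {B} {B'} A≈A' B≈B' = mk≈ λ x →
    subst₂ _≡ₚ_ (sym (coeff-++ A B x)) (sym (coeff-++ A' B' x)) (+-congₚ (coeff-≡ₚ A≈A' x) (coeff-≡ₚ B≈B' x))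

  ⊗-congˡ : ∀ A {B B'} → B ≈ B' → A ⊗ B ≈ A ⊗ B'
  ⊗-congˡ A {B} {B'} B≈B' = mk≈ λ x → subst₂ _≡ₚ_ (sym (coeff-⊗ A B x)) (sym (coeff-⊗ A B' x))
    (∑-congₚ A (λ (a , c) → *-congˡₚ c (coeff-≡ₚ B≈B' (x ⊖ a))))

  ⊗-cong : ∀ {A A' B B'} → A ≈ A' → B ≈ B' → A ⊗ B ≈ A' ⊗ B'
  ⊗-cong {A} {A'} {B} {B'} A≈A' B≈B' = ≈-trans (⊗-congˡ A B≈B') (≈-trans (≐⇒≈ (⊗-comm A B'))
                                         (≈-trans (⊗-congˡ B' A≈A') (≐⇒≈ (⊗-comm B' A'))))

  Laurent/p : CommutativeSemiring 0ℓ 0ℓ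
  Laurent/p = record
    { _≈_ = _≈_ ; _+_ = _++_ ; _*_ = _⊗_ ; 0# = [] ; 1# = one
    ; isCommutativeSemiring = isCommutativeSemiringˡ record
      { +-isCommutativeMonoid = isCommutativeMonoidˡ record
        { isSemigroup = record
          { isMagma = record { isEquivalence = ≈-isEquivalence ; ∙-cong = ++-cong }
          ; assoc = λ A B C → ≡⇒≈ (List.++-assoc A B C) }
        ; identityˡ = λ _ → ≈-refl
        ; comm = λ A B → ≐⇒≈ λ x → trans (coeff-++ A B x)
                   (trans (ℤP.+-comm (coeff A x) (coeff B x)) (sym (coeff-++ B A x))) }
      ; *-isCommutativeMonoid = isCommutativeMonoidˡ record
        { isSemigroup = record
          { isMagma = record { isEquivalence = ≈-isEquivalence ; ∙-cong = ⊗-cong }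
          ; assoc = λ A B C → ≐⇒≈ (⊗-assoc A B C) }
        ; identityˡ = ≐⇒≈ ∘ ⊗-identityˡ
        ; comm = λ A B → ≐⇒≈ (⊗-comm A B) }
      ; distribʳ = λ A B C → ≐⇒≈ (⊗-distribʳ-++ B C A)
      ; zeroˡ = λ _ → ≈-refl } }

  open import Algebra.Properties.Semiring.Exp (CommutativeSemiring.semiring Laurent/p)
    using (^-congˡ; ^-homo-*; ^-assocʳ) renaming (_^_ to _^ₚ_)
  open import Algebra.Definitions.RawMonoid (CommutativeSemiring.+-rawMonoid Laurent/p) using ()
    renaming (_×_ to _·ₚ_)

  ^^≡^ : ∀ (P : LaurentPoly r) n → P ^^ n ≡ P ^ₚ n
  ^^≡^ P zero    = refl
  ^^≡^ P (suc n) = cong (P ⊗_) (^^≡^ P n)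

  ^^-congˡ : ∀ {A B} n → A ≈ B → A ^^ n ≈ B ^^ n
  ^^-congˡ {A} {B} n A≈B = subst₂ _≈_ (sym (^^≡^ A n)) (sym (^^≡^ B n)) (^-congˡ n A≈B)

  ^^-distribˡ-+-⊗ : ∀ (P : LaurentPoly r) m n → P ^^ (m ℕ.+ n) ≈ (P ^^ m) ⊗ (P ^^ n)
  ^^-distribˡ-+-⊗ P m n = subst₂ _≈_ (sym (^^≡^ P (m ℕ.+ n))) (sym (cong₂ _⊗_ (^^≡^ P m) (^^≡^ P n)))
    (^-homo-* P m n)

  ^^-*-assoc : ∀ (P : LaurentPoly r) m n → P ^^ (m ℕ.* n) ≈ (P ^^ m) ^^ n
  ^^-*-assoc P m n = subst₂ _≈_ (sym (^^≡^ P (m ℕ.* n))) (sym (trans (^^≡^ (P ^^ m) n) (cong (_^ₚ n) (^^≡^ P m))))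
    (≈-sym (^-assocʳ P m n))

  ^^p-distrib-++ : ∀ (A B : LaurentPoly r) → (A ++ B) ^^ p ≈ A ^^ p ++ B ^^ p
  ^^p-distrib-++ A B = subst₂ _≈_ (sym (^^≡^ (A ++ B) p)) (sym (cong₂ _++_ (^^≡^ A p) (^^≡^ B p)))
    (Frobenius.prime-^-distrib-+ Laurent/p pr p∣n⇒n·A≈[] A B)
    where
    coeff-· : ∀ n A x → coeff (n ·ₚ A) x ≡ + n * coeff A x
    coeff-· zero    A x = sym (ℤP.*-zeroˡ (coeff A x))
    coeff-· (suc n) A x = trans (coeff-++ A (n ·ₚ A) x)
      (trans (cong (λ y → coeff A x + y) (coeff-· n A x)) (sym (ℤP.suc-* (+ n) (coeff A x))))
    p∣n⇒n·A≈[] : ∀ n A → p ∣ℕ n → n ·ₚ A ≈ []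
    p∣n⇒n·A≈[] n A p∣n = mk≈ λ x → subst (_≡ₚ 0ℤ) (sym (coeff-· n A x))
      (∣⇒≡ₚ0 (Div.∣m⇒∣m*n {m = + n} (coeff A x) (Div.∣ᵤ⇒∣ p∣n)))

  monomial-^^ : ∀ (e : Vec ℤ r) c n → ((e , c) ∷ []) ^^ n ≡ (n · e , c ^ n) ∷ []
  monomial-^^ e c zero    = cong (λ e → (e , 1ℤ) ∷ []) (sym (·-zeroˡ e))
  monomial-^^ e c (suc n) rewrite monomial-^^ e c n = cong (λ e → (e , c * c ^ n) ∷ []) (·-suc n e)

  monomialCoeff-congₚ : ∀ (e : Vec ℤ r) {c c'} x → c ≡ₚ c' → monomialCoeff (e , c) x ≡ₚ monomialCoeff (e , c') x
  monomialCoeff-congₚ e x c≡c' with does (≡-dec ℤ._≟_ e x)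
  ... | true  = c≡c'
  ... | false = ≡ₚ-refl

  -- Frobenius, monomial by monomial, together with Fermat's little theorem for the coefficients.
  ^^p≈dilate : ∀ (P : LaurentPoly r) → P ^^ p ≈ dilate p P
  ^^p≈dilate []            = ≡⇒≈ ([]^^p≡[] p {{prime⇒nonZero pr}})
    where
    []^^p≡[] : ∀ n → .{{NonZero n}} → [] ^^ n ≡ []
    []^^p≡[] (suc n) = refl
  ^^p≈dilate ((e , c) ∷ P) = ≈-trans (^^p-distrib-++ ((e , c) ∷ []) P)
    (++-cong (≈-trans (≡⇒≈ (monomial-^^ e c p)) (mk≈ λ x →
                +-congₚ (monomialCoeff-congₚ (p · e) x (Fermat.fermat pr c)) ≡ₚ-refl))
             (^^p≈dilate P))

  ^^-pⁱ* : ∀ i (P : LaurentPoly r) m → P ^^ (p ℕ.^ i ℕ.* m) ≈ dilate (p ℕ.^ i) (P ^^ m)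
  ^^-pⁱ* zero    P m = ≡⇒≈ (trans (cong (P ^^_) (ℕP.*-identityˡ m)) (sym (dilate-identity (P ^^ m))))
  ^^-pⁱ* (suc i) P m = begin
    P ^^ (p ℕ.* p ℕ.^ i ℕ.* m)               ≡⟨ cong (P ^^_) (ℕP.*-assoc p (p ℕ.^ i) m) ⟩
    P ^^ (p ℕ.* (p ℕ.^ i ℕ.* m))             ≈⟨ ^^-*-assoc P p (p ℕ.^ i ℕ.* m) ⟩
    (P ^^ p) ^^ (p ℕ.^ i ℕ.* m)              ≈⟨ ^^-congˡ (p ℕ.^ i ℕ.* m) (^^p≈dilate P) ⟩
    dilate p P ^^ (p ℕ.^ i ℕ.* m)            ≈⟨ ^^-pⁱ* i (dilate p P) m ⟩
    dilate (p ℕ.^ i) (dilate p P ^^ m)       ≡⟨ cong (dilate (p ℕ.^ i)) (dilate-^^ p P m) ⟨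
    dilate (p ℕ.^ i) (dilate p (P ^^ m))     ≡⟨ dilate-dilate (p ℕ.^ i) p (P ^^ m) ⟩
    dilate (p ℕ.^ i ℕ.* p) (P ^^ m)          ≡⟨ cong (λ s → dilate s (P ^^ m)) (ℕP.*-comm (p ℕ.^ i) p) ⟩
    dilate (p ℕ.* p ℕ.^ i) (P ^^ m)          ∎
    where open import Relation.Binary.Reasoning.Setoid (CommutativeSemiring.setoid Laurent/p)

  ct-cong : ∀ {A B} → A ≈ B → ct A ≡ₚ ct B
  ct-cong {A} {B} A≈B = subst₂ _≡ₚ_ (sym (ct≡coeff0 A)) (sym (ct≡coeff0 B)) (coeff-≡ₚ A≈B 0v)

  ct-⊗-^^-pⁱ* : ∀ {B i} {A : LaurentPoly r} → ExponentsWithin B A → B < p ℕ.^ i →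
                ∀ P m → ct (A ⊗ (P ^^ (p ℕ.^ i ℕ.* m))) ≡ₚ ct A * ct (P ^^ m)
  ct-⊗-^^-pⁱ* {i = i} {A} hA B<pⁱ P m = ≡ₚ-trans (ct-cong (⊗-congˡ A (^^-pⁱ* i P m)))
                                                 (≡⇒≡ₚ (ct-⊗-dilate hA B<pⁱ (P ^^ m)))

module DigitDensity where

  open import Data.Nat using (_+_; _*_; _^_; _/_; _%_; _≟_; >-nonZero; ≢-nonZero)
  open import Data.Nat.Properties
  open import Data.Nat.DivMod
  open import Data.Nat.Divisibility using (divides)
  open import Data.List using (filter; length; upTo; _∷ʳ_)
  import Data.List.Properties as List
  import Data.Nat.Solver as Solver
  open Solver.+-*-Solver
  open ≤-Reasoning

  sumBelow : (ℕ → ℕ) → ℕ → ℕ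
  sumBelow f zero    = 0
  sumBelow f (suc N) = sumBelow f N + f N

  sumBelow-mono-≤ : ∀ {f g} N → (∀ n → n < N → f n ≤ g n) → sumBelow f N ≤ sumBelow g N
  sumBelow-mono-≤ zero    f≤g = z≤n
  sumBelow-mono-≤ (suc N) f≤g = +-mono-≤ (sumBelow-mono-≤ N (λ n n<N → f≤g n (m<n⇒m<1+n n<N))) (f≤g N (n<1+n N))

  sumBelow-cong : ∀ {f g} N → (∀ n → n < N → f n ≡ g n) → sumBelow f N ≡ sumBelow g N
  sumBelow-cong zero    f≡g = refl
  sumBelow-cong (suc N) f≡g = cong₂ _+_ (sumBelow-cong N (λ n n<N → f≡g n (m<n⇒m<1+n n<N))) (f≡g N (n<1+n N))

  sumBelow-+ : ∀ f X Y → sumBelow f (X + Y) ≡ sumBelow f X + sumBelow (λ d → f (X + d)) Y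
  sumBelow-+ f X zero    = trans (cong (sumBelow f) (+-identityʳ X)) (sym (+-identityʳ _))
  sumBelow-+ f X (suc Y) = trans (cong (sumBelow f) (+-suc X Y))
    (trans (cong (_+ f (X + Y)) (sumBelow-+ f X Y)) (+-assoc (sumBelow f X) _ _))

  sumBelow-monoʳ-≤ : ∀ f {N N'} → N ≤ N' → sumBelow f N ≤ sumBelow f N'
  sumBelow-monoʳ-≤ f {N} {N'} N≤N' = begin
    sumBelow f N                                            ≤⟨ m≤m+n _ _ ⟩
    sumBelow f N + sumBelow (λ d → f (N + d)) (N' ∸ N)      ≡⟨ sumBelow-+ f N (N' ∸ N) ⟨
    sumBelow f (N + (N' ∸ N))                               ≡⟨ cong (sumBelow f) (m+[n∸m]≡n N≤N') ⟩
    sumBelow f N'                                           ∎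

  sumBelow-const : ∀ c N → sumBelow (λ _ → c) N ≡ N * c
  sumBelow-const c zero    = refl
  sumBelow-const c (suc N) = trans (cong (_+ c) (sumBelow-const c N)) (+-comm (N * c) c)

  sumBelow-*ˡ : ∀ c f N → sumBelow (λ n → c * f n) N ≡ c * sumBelow f N
  sumBelow-*ˡ c f zero    = sym (*-zeroʳ c)
  sumBelow-*ˡ c f (suc N) = trans (cong (_+ c * f N) (sumBelow-*ˡ c f N)) (sym (*-distribˡ-+ c (sumBelow f N) (f N)))

  sumBelow-blocks : ∀ a b f → sumBelow f (b * a) ≡ sumBelow (λ v → sumBelow (λ d → f (v * a + d)) a) b
  sumBelow-blocks a zero    f = refl
  sumBelow-blocks a (suc b) f = trans (cong (sumBelow f) (+-comm a (b * a)))
    (trans (sumBelow-+ f (b * a) a) (cong (_+ sumBelow (λ d → f (b * a + d)) a) (sumBelow-blocks a b f)))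

  -- The sum is at most (N - 1)·Y, stated without truncated subtraction.
  sumBelow-with-zero : ∀ g Y w N → (∀ d → d < N → g d ≤ Y) → g w ≡ 0 → w < N → sumBelow g N + Y ≤ N * Y
  sumBelow-with-zero g Y w (suc N) g≤Y gw≡0 w<1+N with m<1+n⇒m<n∨m≡n w<1+N
  ... | inj₁ w<N = begin
      sumBelow g N + g N + Y   ≡⟨ solve 3 (λ s x y → s :+ x :+ y := (s :+ y) :+ x) refl (sumBelow g N) (g N) Y ⟩
      sumBelow g N + Y + g N   ≤⟨ +-mono-≤ (sumBelow-with-zero g Y w N (λ d d<N → g≤Y d (m<n⇒m<1+n d<N)) gw≡0 w<N)
                                           (g≤Y N (n<1+n N)) ⟩
      N * Y + Y                ≡⟨ +-comm (N * Y) Y ⟩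
      suc N * Y                ∎
  ... | inj₂ refl = begin
      sumBelow g N + g N + Y   ≡⟨ cong (λ z → sumBelow g N + z + Y) gw≡0 ⟩
      sumBelow g N + 0 + Y     ≤⟨ +-monoˡ-≤ Y (+-monoˡ-≤ 0 (subst (sumBelow g N ≤_) (sumBelow-const Y N)
                                   (sumBelow-mono-≤ N (λ d d<N → g≤Y d (m<n⇒m<1+n d<N))))) ⟩
      N * Y + 0 + Y            ≡⟨ solve 2 (λ n y → n :* y :+ con 0 :+ y := y :+ n :* y) refl N Y ⟩
      suc N * Y                ∎

  [v*a+d]/a≡v : ∀ v a d .{{_ : NonZero a}} → d < a → (v * a + d) / a ≡ v
  [v*a+d]/a≡v v a d d<a =
    trans (+-distrib-/-∣ˡ d (divides v refl)) (trans (cong₂ _+_ (m*n/n≡m v a) (m<n⇒m/n≡0 d<a)) (+-identityʳ v))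

  [v*a+d]%a≡d : ∀ v a d .{{_ : NonZero a}} → d < a → (v * a + d) % a ≡ d
  [v*a+d]%a≡d v a d d<a = trans (cong (_% a) (+-comm (v * a) d)) (trans ([m+kn]%n≡m%n d v a) (m<n⇒m%n≡m d<a))

  n<m^n : ∀ {m} → 1 < m → ∀ n → n < m ^ n
  n<m^n 1<m zero    = z<s
  n<m^n {m} 1<m (suc n) = begin-strict
    suc n              <⟨ s<s (n<m^n 1<m n) ⟩
    suc (m ^ n)        ≤⟨ +-monoˡ-≤ (m ^ n) (m^n>0 m n) ⟩
    m ^ n + m ^ n      ≡⟨ cong (m ^ n +_) (+-identityʳ (m ^ n)) ⟨
    2 * m ^ n          ≤⟨ *-monoˡ-≤ (m ^ n) 1<m ⟩
    m * m ^ n          ∎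
    where instance _ = >-nonZero (<-trans z<s 1<m)

  bernoulli : ∀ b M → b ^ M * (b + M) ≤ b * suc b ^ M
  bernoulli b zero    = ≤-reflexive (solve 1 (λ b → con 1 :* (b :+ con 0) := b :* con 1) refl b)
  bernoulli b (suc M) = begin
    b * b ^ M * (b + suc M)
      ≡⟨ solve 3 (λ b x m → b :* x :* (b :+ (con 1 :+ m)) := b :* (x :* (b :+ m)) :+ x :* b) refl b (b ^ M) M ⟩
    b * (b ^ M * (b + M)) + b ^ M * b
      ≤⟨ +-monoʳ-≤ (b * (b ^ M * (b + M))) (*-monoʳ-≤ (b ^ M) (m≤m+n b M)) ⟩
    b * (b ^ M * (b + M)) + b ^ M * (b + M)
      ≡⟨ solve 2 (λ b y → b :* y :+ y := (con 1 :+ b) :* y) refl b (b ^ M * (b + M)) ⟩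
    suc b * (b ^ M * (b + M))
      ≤⟨ *-monoʳ-≤ (suc b) (bernoulli b M) ⟩
    suc b * (b * suc b ^ M)
      ≡⟨ solve 3 (λ c b z → c :* (b :* z) := b :* (c :* z)) refl (suc b) b (suc b ^ M) ⟩
    b * suc b ^ suc M ∎

  -- Bernoulli's inequality at M = 2kb: (1 + 1/b)^M ≥ 1 + M/b = 1 + 2k.
  2k*b^M≤[1+b]^M : ∀ b k .{{_ : NonZero b}} → 2 * k * b ^ (2 * k * b) ≤ suc b ^ (2 * k * b)
  2k*b^M≤[1+b]^M b k = *-cancelˡ-≤ b (begin
    b * (2 * k * b ^ M)
      ≤⟨ m≤n+m _ (b ^ M * b) ⟩
    b ^ M * b + b * (2 * k * b ^ M)
      ≡⟨ solve 3 (λ x b c → x :* b :+ b :* (c :* x) := x :* (b :+ c :* b)) refl (b ^ M) b (2 * k) ⟩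
    b ^ M * (b + M)
      ≤⟨ bernoulli b M ⟩
    b * suc b ^ M ∎)
    where M = 2 * k * b

  isNonzero : ℕ → ℕ
  isNonzero zero    = 0
  isNonzero (suc _) = 1

  isNonzero-≢0 : ∀ {x} → x ≢ 0 → isNonzero x ≡ 1
  isNonzero-≢0 {zero}  0≢0 = ⊥-elim (0≢0 refl)
  isNonzero-≢0 {suc _} _   = refl

  nonzeroCount : (ℕ → ℕ) → ℕ → ℕ
  nonzeroCount s = sumBelow (isNonzero ∘ s)

  zeroCount+nonzeroCount : ∀ s N → zeroCount s N + nonzeroCount s N ≡ N
  zeroCount+nonzeroCount s zero    = refl
  zeroCount+nonzeroCount s (suc N) = begin-equality
    length (filter P? (upTo (suc N))) + R
      ≡⟨ cong (λ ns → length (filter P? ns) + R) (List.upTo-∷ʳ N) ⟨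
    length (filter P? (upTo N ∷ʳ N)) + R
      ≡⟨ cong (λ ns → length ns + R) (List.filter-++ P? (upTo N) (N ∷ [])) ⟩
    length (filter P? (upTo N) ++ filter P? (N ∷ [])) + R
      ≡⟨ cong (_+ R) (List.length-++ (filter P? (upTo N))) ⟩
    zeroCount s N + length (filter P? (N ∷ [])) + R
      ≡⟨ solve 4 (λ z f n i → z :+ f :+ (n :+ i) := (z :+ n) :+ (f :+ i)) refl
                 (zeroCount s N) (length (filter P? (N ∷ []))) (nonzeroCount s N) (isNonzero (s N)) ⟩
    (zeroCount s N + nonzeroCount s N) + (length (filter P? (N ∷ [])) + isNonzero (s N))
      ≡⟨ cong₂ _+_ (zeroCount+nonzeroCount s N) (last-step (s N ≟ 0)) ⟩
    N + 1
      ≡⟨ +-comm N 1 ⟩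
    suc N ∎
    where
    P? = λ n → s n ≟ 0
    R = nonzeroCount s N + isNonzero (s N)
    last-step : Dec (s N ≡ 0) → length (filter P? (N ∷ [])) + isNonzero (s N) ≡ 1
    last-step (yes sN≡0) rewrite List.filter-accept P? {xs = []} sN≡0 | sN≡0 = refl
    last-step (no sN≢0) rewrite List.filter-reject P? {xs = []} sN≢0 = isNonzero-≢0 sN≢0

  nonzeroCount≡ : ∀ s N → N ∸ zeroCount s N ≡ nonzeroCount s N
  nonzeroCount≡ s N = trans (cong (_∸ zeroCount s N) (sym (zeroCount+nonzeroCount s N)))
                            (m+n∸m≡n (zeroCount s N) (nonzeroCount s N))

  digit : (q : ℕ) .{{_ : NonZero q}} → ℕ → ℕ → ℕ
  digit q i u = (u / q ^ i) {{m^n≢0 q i}} % q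

  module _ (q w : ℕ) .{{_ : NonZero q}} where

    avoids : ℕ → ℕ → ℕ
    avoids zero    u = 1
    avoids (suc M) u with u % q ≟ w
    ... | yes _ = 0
    ... | no  _ = avoids M (u / q)

    isNonzero≤avoids : ∀ x M u → (∀ i → digit q i u ≡ w → x ≡ 0) → isNonzero x ≤ avoids M u
    isNonzero≤avoids zero    M       u _ = z≤n
    isNonzero≤avoids (suc x) zero    u _ = ≤-refl
    isNonzero≤avoids (suc x) (suc M) u digit≡w⇒x≡0 with u % q ≟ w
    ... | yes u%q≡w with () ← digit≡w⇒x≡0 0 (trans (cong (_% q) (n/1≡n u)) u%q≡w)
    ... | no  _     = isNonzero≤avoids (suc x) M (u / q) λ i digit≡w →
      digit≡w⇒x≡0 (suc i) (trans (cong (_% q) (sym (m/n/o≡m/[n*o] u q (q ^ i) {{_}} {{m^n≢0 q i}} {{m^n≢0 q (suc i)}})))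
                                 digit≡w)

    -- Each block of q consecutive values of u contributes at most q - 1 times the count one level up.
    sumBelow-avoids : w < q → ∀ M X → sumBelow (avoids M) (q ^ M * X) ≤ X * (q ∸ 1) ^ M
    sumBelow-avoids w<q zero    X =
      ≤-reflexive (trans (sumBelow-const 1 (1 * X)) (solve 1 (λ x → (con 1 :* x) :* con 1 := x :* con 1) refl X))
    sumBelow-avoids w<q (suc M) X = begin
      sumBelow (avoids (suc M)) (q ^ suc M * X)
        ≡⟨ cong (sumBelow (avoids (suc M))) (solve 3 (λ q y x → q :* y :* x := y :* x :* q) refl q (q ^ M) X) ⟩
      sumBelow (avoids (suc M)) (b * q)
        ≡⟨ sumBelow-blocks q b (avoids (suc M)) ⟩
      sumBelow (λ v → sumBelow (λ d → avoids (suc M) (v * q + d)) q) b ≤⟨ sumBelow-mono-≤ b (λ v _ → block v) ⟩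
      sumBelow (λ v → (q ∸ 1) * avoids M v) b
        ≡⟨ sumBelow-*ˡ (q ∸ 1) (avoids M) b ⟩
      (q ∸ 1) * sumBelow (avoids M) b
        ≤⟨ *-monoʳ-≤ (q ∸ 1) (sumBelow-avoids w<q M X) ⟩
      (q ∸ 1) * (X * (q ∸ 1) ^ M)
        ≡⟨ solve 3 (λ a x y → a :* (x :* y) := x :* (a :* y)) refl (q ∸ 1) X ((q ∸ 1) ^ M) ⟩
      X * (q ∸ 1) ^ suc M ∎
      where
      b = q ^ M * X
      digit≤ : ∀ v d → d < q → avoids (suc M) (v * q + d) ≤ avoids M v
      digit≤ v d d<q with (v * q + d) % q ≟ w
      ... | yes _ = z≤n
      ... | no  _ = ≤-reflexive (cong (avoids M) ([v*a+d]/a≡v v q d d<q))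
      digit≡w : ∀ v → avoids (suc M) (v * q + w) ≡ 0
      digit≡w v with (v * q + w) % q ≟ w
      ... | yes _ = refl
      ... | no  ≢ = ⊥-elim (≢ ([v*a+d]%a≡d v q w w<q))
      block : ∀ v → sumBelow (λ d → avoids (suc M) (v * q + d)) q ≤ (q ∸ 1) * avoids M v
      block v = +-cancelʳ-≤ (avoids M v) _ _ (begin
        sumBelow (λ d → avoids (suc M) (v * q + d)) q + avoids M v
          ≤⟨ sumBelow-with-zero _ (avoids M v) w q (digit≤ v) (digit≡w v) w<q ⟩
        q * avoids M v
          ≡⟨ cong (_* avoids M v) (suc-pred q) ⟨
        suc (q ∸ 1) * avoids M v
          ≡⟨ +-comm (avoids M v) ((q ∸ 1) * avoids M v) ⟩
        (q ∸ 1) * avoids M v + avoids M v ∎)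

  module _ (s : ℕ → ℕ) (K q w : ℕ) .{{_ : NonZero K}} .{{_ : NonZero q}} (w<q : w < q)
           (digit≡w⇒zero : ∀ n i → digit q i (n / K) ≡ w → s n ≡ 0) where

    nonzeroCount≤ : ∀ M c → nonzeroCount s (c * q ^ M * K) ≤ K * (c * (q ∸ 1) ^ M)
    nonzeroCount≤ M c = begin
      sumBelow (isNonzero ∘ s) (c * q ^ M * K)
        ≤⟨ sumBelow-mono-≤ (c * q ^ M * K) (λ n _ →
          isNonzero≤avoids q w (s n) M (n / K) (digit≡w⇒zero n)) ⟩
      sumBelow (λ n → avoids q w M (n / K)) (c * q ^ M * K)
        ≡⟨ sumBelow-blocks K (c * q ^ M) _ ⟩
      sumBelow (λ v → sumBelow (λ d → avoids q w M ((v * K + d) / K)) K) (c * q ^ M)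
        ≡⟨ sumBelow-cong (c * q ^ M) (λ v _ →
             trans (sumBelow-cong K (λ d d<K → cong (avoids q w M) ([v*a+d]/a≡v v K d d<K)))
                   (sumBelow-const (avoids q w M v) K)) ⟩
      sumBelow (λ v → K * avoids q w M v) (c * q ^ M)
        ≡⟨ sumBelow-*ˡ K (avoids q w M) (c * q ^ M) ⟩
      K * sumBelow (avoids q w M) (c * q ^ M)
        ≤⟨ *-monoʳ-≤ K (subst (λ N → sumBelow (avoids q w M) N ≤ c * (q ∸ 1) ^ M)
          (*-comm (q ^ M) c) (sumBelow-avoids q w w<q M c)) ⟩
      K * (c * (q ∸ 1) ^ M) ∎

    -- With M = 2k(q-1), at most a 1/(2k) fraction of every q^M·K consecutive n is nonzero.
    digitAvoidance⇒zeroDensityOne : 1 < q → ZeroDensityOne s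
    digitAvoidance⇒zeroDensityOne 1<q k = N₀ , λ N N₀≤N → *-cancelˡ-≤ 2 (begin
        2 * (k * (N ∸ zeroCount s N))
          ≡⟨ cong (λ z → 2 * (k * z)) (nonzeroCount≡ s N) ⟩
        2 * (k * nonzeroCount s N)
          ≤⟨ *-monoʳ-≤ 2 (*-monoʳ-≤ k (nonzeroCount≤' N)) ⟩
        2 * (k * (K * (suc (N / T) * R)))
          ≡⟨ solve 4 (λ k K c R → con 2 :* (k :* (K :* ((con 1 :+ c) :* R)))
                                := (con 2 :* k :* R) :* K :* c :+ con 2 :* (k :* (K :* R))) refl k K (N / T) R ⟩
        2 * k * R * K * (N / T) + N₀
          ≤⟨ +-mono-≤ (*-monoˡ-≤ (N / T) (*-monoˡ-≤ K 2kR≤q^M)) N₀≤N ⟩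
        q ^ M * K * (N / T) + N
          ≡⟨ cong (_+ N) (solve 3 (λ Q K x → Q :* K :* x := x :* (K :* Q)) refl (q ^ M) K (N / T)) ⟩
        N / T * T + N
          ≤⟨ +-monoˡ-≤ N (m/n*n≤m N T) ⟩
        N + N
          ≡⟨ solve 1 (λ n → n :+ n := con 2 :* n) refl N ⟩
        2 * N ∎)
      where
      b = q ∸ 1
      instance _ = ≢-nonZero (λ b≡0 → <⇒≱ 1<q (≤-reflexive (trans (sym (suc-pred q)) (cong suc b≡0))))
      M = 2 * k * b
      R = b ^ M
      T = K * q ^ M
      instance _ = m*n≢0 K (q ^ M) {{it}} {{m^n≢0 q M}}
      N₀ = 2 * (k * (K * R))
      2kR≤q^M : 2 * k * R ≤ q ^ M
      2kR≤q^M = subst (λ q → 2 * k * R ≤ q ^ M) (suc-pred q) (2k*b^M≤[1+b]^M b k)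
      nonzeroCount≤' : ∀ N → nonzeroCount s N ≤ K * (suc (N / T) * R)
      nonzeroCount≤' N = ≤-trans (sumBelow-monoʳ-≤ (isNonzero ∘ s) N≤) (nonzeroCount≤ M (suc (N / T)))
        where
        N≤ : N ≤ suc (N / T) * q ^ M * K
        N≤ = begin
          N
            ≡⟨ m≡m%n+[m/n]*n N T ⟩
          N % T + N / T * T
            ≤⟨ +-monoˡ-≤ (N / T * T) (<⇒≤ (m%n<n N T)) ⟩
          T + N / T * T
            ≡⟨ solve 3 (λ K Q x → K :* Q :+ x :* (K :* Q) := (con 1 :+ x) :* Q :* K) refl K (q ^ M) (N / T) ⟩
          suc (N / T) * q ^ M * K ∎

module DigitVanishing {p : ℕ} (pr : Prime p) {r : ℕ} (P Q : LaurentPoly r) (N₀ : ℕ)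
                      (p∣ctPᴺ⁰ : ℤ.+ p ∣ℤ ct (P ^^ N₀)) where

  open import Data.Nat using (_+_; _*_; _^_; _/_; _%_)
  open import Data.Nat.Properties
  open import Data.Nat.DivMod using (m≡m%n+[m/n]*n; m%n<n; m<n⇒m%n≡m; m/n/o≡m/[n*o]; /-congʳ)
  import Data.Integer.Divisibility.Signed as Div
  import Data.Nat.Solver as Solver
  open Solver.+-*-Solver
  open import Algebra.Properties.CommutativeSemigroup using (xy∙z≈xz∙y)
  open Dilation using (ExponentsWithin; exponentsWithin-exists; exponentsWithin-^^; exponentsWithin-⊗)
  open Congruence p using (≡ₚ-∣; ≡ₚ-trans)
  open LaurentModP pr r
  open DigitDensity using (n<m^n)

  instance
    _ = prime⇒nonZero pr

  1<p : 1 < p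
  1<p = ℕ.nonTrivial⇒n>1 p {{prime⇒nonTrivial pr}}

  d D : ℕ
  d = proj₁ (exponentsWithin-exists P)
  D = proj₁ (exponentsWithin-exists Q)

  hP : ExponentsWithin d P
  hP = proj₂ (exponentsWithin-exists P)

  hQ : ExponentsWithin D Q
  hQ = proj₂ (exponentsWithin-exists Q)

  -- n is split in base p as a + p^(k+j)·(N₀ + p^t·m) with a < p^k: the j extra digits make room for
  -- the exponents of P^a·Q, the t digits for those of P^N₀.
  j t : ℕ
  j = suc d
  t = N₀ * j

  q w : ℕ
  q = p ^ (j + t)
  w = p ^ j * N₀

  instance
    q≢0 : NonZero q
    q≢0 = m^n≢0 p (j + t)

  p∣ct-^^[N₀+pᵗ*m] : ∀ m → ℤ.+ p ∣ℤ ct (P ^^ (N₀ + p ^ t * m))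
  p∣ct-^^[N₀+pᵗ*m] m = ≡ₚ-∣ (≡ₚ-trans (ct-cong (^^-distribˡ-+-⊗ P N₀ (p ^ t * m)))
                                      (ct-⊗-^^-pⁱ* {i = t} (exponentsWithin-^^ N₀ hP) N₀d<pᵗ P m))
                           (Div.∣m⇒∣m*n (ct (P ^^ m)) p∣ctPᴺ⁰)
    where
    N₀d<pᵗ : N₀ * d < p ^ t
    N₀d<pᵗ = ≤-<-trans (*-monoʳ-≤ N₀ (n≤1+n d)) (n<m^n 1<p t)

  p∣ct-low+high : ∀ k a m → a < p ^ k → D ≤ k → ℤ.+ p ∣ℤ ct ((P ^^ (a + p ^ (k + j) * (N₀ + p ^ t * m))) ⊗ Q)
  p∣ct-low+high k a m a<pᵏ D≤k =
    ≡ₚ-∣ (≡ₚ-trans (ct-cong rearrange) (ct-⊗-^^-pⁱ* {i = k + j} within small P M))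
         (Div.∣n⇒∣m*n (ct ((P ^^ a) ⊗ Q)) (p∣ct-^^[N₀+pᵗ*m] m))
    where
    M = N₀ + p ^ t * m
    module Lp = CommutativeSemiring Laurent/p
    rearrange : (P ^^ (a + p ^ (k + j) * M)) ⊗ Q ≈ ((P ^^ a) ⊗ Q) ⊗ (P ^^ (p ^ (k + j) * M))
    rearrange = ≈-trans (Lp.*-congʳ (^^-distribˡ-+-⊗ P a _))
                        (xy∙z≈xz∙y Lp.*-commutativeSemigroup (P ^^ a) (P ^^ (p ^ (k + j) * M)) Q)
    within : ExponentsWithin (a * d + D) ((P ^^ a) ⊗ Q)
    within = exponentsWithin-⊗ (exponentsWithin-^^ a hP) hQ
    small : a * d + D < p ^ (k + j)
    small = begin-strict
      a * d + D           <⟨ +-mono-≤-< (*-monoˡ-≤ d (<⇒≤ a<pᵏ)) (≤-<-trans D≤k (n<m^n 1<p k)) ⟩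
      p ^ k * d + p ^ k   ≡⟨ solve 2 (λ K d → K :* d :+ K := K :* (con 1 :+ d)) refl (p ^ k) d ⟩
      p ^ k * j           ≤⟨ *-monoʳ-≤ (p ^ k) (<⇒≤ (n<m^n 1<p j)) ⟩
      p ^ k * p ^ j       ≡⟨ ^-distribˡ-+-* p k j ⟨
      p ^ (k + j)         ∎
      where open ≤-Reasoning

  dropDigits : ℕ → ℕ → ℕ
  dropDigits k n = (n / p ^ k) {{m^n≢0 p k}}

  p∣ct-digit : ∀ k n → D ≤ k → dropDigits k n % q ≡ w → ℤ.+ p ∣ℤ ct ((P ^^ n) ⊗ Q)
  p∣ct-digit k n D≤k digit≡w = subst (λ n → ℤ.+ p ∣ℤ ct ((P ^^ n) ⊗ Q)) (sym n≡)
    (p∣ct-low+high k a m (m%n<n n (p ^ k) {{pᵏ≢0}}) D≤k)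
    where
    pᵏ≢0 = m^n≢0 p k
    a = (n % p ^ k) {{pᵏ≢0}}
    u = (n / p ^ k) {{pᵏ≢0}}
    m = u / q
    n≡ : n ≡ a + p ^ (k + j) * (N₀ + p ^ t * m)
    n≡ = begin
      n
        ≡⟨ m≡m%n+[m/n]*n n (p ^ k) {{pᵏ≢0}} ⟩
      a + u * p ^ k
        ≡⟨ cong (λ u → a + u * p ^ k) (m≡m%n+[m/n]*n u q) ⟩
      a + (u % q + m * q) * p ^ k
        ≡⟨ cong (λ z → a + (z + m * q) * p ^ k) digit≡w ⟩
      a + (p ^ j * N₀ + m * p ^ (j + t)) * p ^ k
        ≡⟨ cong (λ z → a + (p ^ j * N₀ + m * z) * p ^ k) (^-distribˡ-+-* p j t) ⟩
      a + (p ^ j * N₀ + m * (p ^ j * p ^ t)) * p ^ k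
        ≡⟨ solve 6 (λ a pj n m pt pk → a :+ (pj :* n :+ m :* (pj :* pt)) :* pk
          := a :+ pk :* pj :* (n :+ pt :* m)) refl a (p ^ j) N₀ m (p ^ t) (p ^ k) ⟩
      a + p ^ k * p ^ j * (N₀ + p ^ t * m)
        ≡⟨ cong (λ z → a + z * (N₀ + p ^ t * m)) (^-distribˡ-+-* p k j) ⟨
      a + p ^ (k + j) * (N₀ + p ^ t * m) ∎
      where open ≡-Reasoning

  w<q : w < q
  w<q = begin-strict
    p ^ j * N₀        <⟨ *-monoʳ-< (p ^ j) {{m^n≢0 p j}} (<-≤-trans (n<m^n 1<p N₀) (^-monoʳ-≤ p (m≤m*n N₀ j))) ⟩
    p ^ j * p ^ t     ≡⟨ ^-distribˡ-+-* p j t ⟨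
    p ^ (j + t)       ∎
    where open ≤-Reasoning

  p∣ct-run : ∀ L → ∃[ i ] ∀ i' → i' < L → ℤ.+ p ∣ℤ ct ((P ^^ (i + i')) ⊗ Q)
  p∣ct-run L = w * p ^ (D + L) , λ i' i'<L → p∣ct-digit (D + L) (w * p ^ (D + L) + i') (m≤m+n D L)
    (trans (cong (_% q) (DigitDensity.[v*a+d]/a≡v w (p ^ (D + L)) i' {{m^n≢0 p (D + L)}} (i'<pᴰ⁺ᴸ i'<L)))
           (m<n⇒m%n≡m w<q))
    where
    i'<pᴰ⁺ᴸ : ∀ {i'} → i' < L → i' < p ^ (D + L)
    i'<pᴰ⁺ᴸ i'<L = <-≤-trans i'<L (≤-trans (m≤n+m L D) (<⇒≤ (n<m^n 1<p (D + L))))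

  digit-dropDigits : ∀ n i → DigitDensity.digit q i (dropDigits D n) ≡ dropDigits (D + (j + t) * i) n % q
  digit-dropDigits n i = cong (_% q) (trans
    (m/n/o≡m/[n*o] n (p ^ D) (q ^ i) {{m^n≢0 p D}} {{m^n≢0 q i}} {{m*n≢0 (p ^ D) (q ^ i) {{m^n≢0 p D}} {{m^n≢0 q i}}}})
    (/-congʳ {{_}} {{m^n≢0 p (D + (j + t) * i)}} pᴰqⁱ≡))
    where
    pᴰqⁱ≡ : p ^ D * q ^ i ≡ p ^ (D + (j + t) * i)
    pᴰqⁱ≡ = trans (cong (p ^ D *_) (^-*-assoc p (j + t) i)) (sym (^-distribˡ-+-* p D ((j + t) * i)))

  p∣ct-digitᴰ : ∀ n i → DigitDensity.digit q i (dropDigits D n) ≡ w → ℤ.+ p ∣ℤ ct ((P ^^ n) ⊗ Q)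
  p∣ct-digitᴰ n i digit≡w =
    p∣ct-digit (D + (j + t) * i) n (m≤m+n D _) (trans (sym (digit-dropDigits n i)) digit≡w)

  1<q : 1 < q
  1<q = <-≤-trans 1<p (m≤m*n p (p ^ (d + t)) {{m^n≢0 p (d + t)}})

module UniformRecurrence {A : Set} (s : ℕ → A) where

  open import Data.Nat using (_+_; s≤s⁻¹)
  open import Data.Nat.Properties

  occurrence-within : ∀ {m} (w : Vec A m) n C → OccursAt s w n →
    (∀ i → OccursAt s w i → ∃[ i' ] (i < i' × i' ≤ i + C × OccursAt s w i')) →
    ∀ x → ∃[ i ] (OccursAt s w i × i ≤ n + x × n + x ≤ i + C)
  occurrence-within w n C occₙ next zero = n , occₙ , m≤m+n n 0 , +-monoʳ-≤ n z≤n
  occurrence-within w n C occₙ next (suc x) with occurrence-within w n C occₙ next x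
  ... | i , occᵢ , i≤n+x , n+x≤i+C with n + suc x ≤? i + C
  ...   | yes n+1+x≤i+C = i , occᵢ , ≤-trans i≤n+x (+-monoʳ-≤ n (n≤1+n x)) , n+1+x≤i+C
  ...   | no  n+1+x≰i+C with i' , i<i' , i'≤i+C , occᵢ' ← next i occᵢ =
    i' , occᵢ' , ≤-trans i'≤i+C (≤-trans i+C≤n+x (+-monoʳ-≤ n (n≤1+n x))) ,
    ≤-trans (≤-reflexive (+-suc n x)) (≤-trans (s≤s n+x≤i+C) (+-monoˡ-≤ C i<i'))
    where
    i+C≤n+x : i + C ≤ n + x
    i+C≤n+x = s≤s⁻¹ (≤-trans (≰⇒> n+1+x≰i+C) (≤-reflexive (+-suc n x)))

  occurs-at-self : ∀ n → OccursAt s (s n ∷ []) n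
  occurs-at-self n F.zero = cong s (+-identityʳ n)

  constRuns∧uniformlyRecurrent⇒const : ∀ {z} → (∀ L → ∃[ i ] ∀ i' → i' < L → s (i + i') ≡ z) →
                                      UniformlyRecurrent s → ∀ n → s n ≡ z
  constRuns∧uniformlyRecurrent⇒const runs ur n
    with C , next ← ur 1 (s n ∷ []) (n , occurs-at-self n)
    with i₀ , run ← runs (n + suc C)
    with i , occᵢ , i≤ , ≤i+C ← occurrence-within (s n ∷ []) n C (occurs-at-self n) next (i₀ + C) =
    trans (sym (occᵢ F.zero)) (trans (cong s (trans (+-identityʳ i) (sym (m+[n∸m]≡n i₀≤i)))) (run (i ∸ i₀) i-i₀<n+1+C))
    where
    n+i₀≤i : n + i₀ ≤ i
    n+i₀≤i = +-cancelʳ-≤ C (n + i₀) i (≤-trans (≤-reflexive (+-assoc n i₀ C)) ≤i+C)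
    i₀≤i : i₀ ≤ i
    i₀≤i = ≤-trans (m≤n+m i₀ n) n+i₀≤i
    i-i₀<n+1+C : i ∸ i₀ < n + suc C
    i-i₀<n+1+C = begin-strict
      i ∸ i₀
        ≤⟨ ∸-monoˡ-≤ i₀ i≤ ⟩
      n + (i₀ + C) ∸ i₀
        ≡⟨ cong (_∸ i₀) (trans (sym (+-assoc n i₀ C)) (trans (cong (_+ C) (+-comm n i₀)) (+-assoc i₀ n C))) ⟩
      i₀ + (n + C) ∸ i₀
        ≡⟨ m+n∸m≡n i₀ (n + C) ⟩
      n + C
        <⟨ +-monoʳ-< n (n<1+n C) ⟩
      n + suc C ∎
      where open ≤-Reasoning

open import Data.Integer using (+_)
open import Data.Integer.Divisibility using (_∣_)
open import Data.Nat using (_^_)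
open import Data.Nat.Properties using (m^n≢0)
open DigitDensity using (digitAvoidance⇒zeroDensityOne)

theorem14 : ∀ (r : ℕ) (P : LaurentPoly r) (p : ℕ) (pr : Prime p) →
    ∃[ n ] (+ p ∣ ct (P ^^ n)) →
    ∀ (Q : LaurentPoly r) →
    ZeroDensityOne (ctSeqMod p pr P Q)
    × ArbLongZeroRuns (ctSeqMod p pr P Q)
    × (¬ (∀ n → ctSeqMod p pr P Q n ≡ 0) → ¬ UniformlyRecurrent (ctSeqMod p pr P Q))
theorem14 r P p pr (N₀ , p∣ctPᴺ⁰) Q = density , runs , λ s≢0 ur → s≢0 (constRuns∧uniformlyRecurrent⇒const runs ur)
  where
  open DigitVanishing pr P Q N₀ (∣ᵤ⇒∣ p∣ctPᴺ⁰)
  open UniformRecurrence (ctSeqMod p pr P Q)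
  vanishes : ∀ {n} → + p ∣ℤ ct ((P ^^ n) ⊗ Q) → ctSeqMod p pr P Q n ≡ 0
  vanishes = Congruence.∣⇒%ℕ≡0 p {{prime⇒nonZero pr}}
  runs : ArbLongZeroRuns (ctSeqMod p pr P Q)
  runs L = map₂ (λ {i} p∣ct i' i'<L → vanishes {i ℕ.+ i'} (p∣ct i' i'<L)) (p∣ct-run L)
  density : ZeroDensityOne (ctSeqMod p pr P Q)
  density = digitAvoidance⇒zeroDensityOne (ctSeqMod p pr P Q) (p ^ D) q w {{m^n≢0 p D {{prime⇒nonZero pr}}}} w<q
    (λ n i → vanishes {n} ∘ p∣ct-digitᴰ n i) 1<q
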